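{- Let $G$ be a connected graph and let $v$ be a vertex of $G$ with exactly two neighbors $u$ and $w$. The following three conditions are equivalent: (1) $v$ is an articulation point of $G$; (2) the edges $(u,v)$ and $(v,w)$ are both bridges of $G$; (3) for every vertex $v'\neq v$, $|d(u,v')-d(w,v')|=2$, where $d$ denotes shortest-path distance in $G$.
   Context: An articulation point of a connected graph is a vertex whose removal increases the number of connected components. A bridge is an edge whose deletion increases the number of connected components. -}

module Defs where

open import Data.Nat using (ℕ; zero; suc; _<_; ∣_-_∣)
open import Data.Fin using (Fin)
open import Data.Product using (_×_; ∃; ∃-syntax; Σ-syntax)
open import Data.Sum using (_⊎_)
open import Relation.Binary.PropositionalEquality using (_≡_; _≢_)
open import Relation.Nullary using (¬_)

record Graph (n : ℕ) : Set₁ where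
  field
    Adj   : Fin n → Fin n → Set
    sym   : ∀ {x y} → Adj x y → Adj y x
    irrefl : ∀ {x} → ¬ Adj x x
open Graph public

EdgeRel : ℕ → Set₁
EdgeRel n = Fin n → Fin n → Set

data Walk {n : ℕ} (E : EdgeRel n) : Fin n → Fin n → ℕ → Set where
  [] : ∀ {x} → Walk E x x zero
  _∷_ : ∀ {x y z k} → E x y → Walk E y z k → Walk E x z (suc k)

Reachable : ∀ {n} → EdgeRel n → Fin n → Fin n → Set
Reachable E x y = ∃[ k ] Walk E x y k

Connected : ∀ {n} → Graph n → Set
Connected G = ∀ x y → Reachable (Adj G) x y

deleteVertex : ∀ {n} → Graph n → Fin n → EdgeRel n
deleteVertex G v a b = Adj G a b × a ≢ v × b ≢ v

deleteEdge : ∀ {n} → Graph n → Fin n → Fin n → EdgeRel n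
deleteEdge G a b x y = Adj G x y × ¬ ((x ≡ a × y ≡ b) ⊎ (x ≡ b × y ≡ a))

-- v is an articulation point: deleting v increases the number of connected
-- components, i.e. two vertices of G - v lying in the same component of G
-- are in different components of G - v.
IsArticulationPoint : ∀ {n} → Graph n → Fin n → Set
IsArticulationPoint G v =
  ∃[ x ] ∃[ y ] (x ≢ v × y ≢ v × Reachable (Adj G) x y × ¬ Reachable (deleteVertex G v) x y)

-- The edge {a,b} is a bridge: it is an edge and deleting it increases the
-- number of connected components, i.e. it separates two vertices that were
-- in the same component of G.
IsBridge : ∀ {n} → Graph n → Fin n → Fin n → Set
IsBridge G a b =
  Adj G a b × ∃[ x ] ∃[ y ] (Reachable (Adj G) x y × ¬ Reachable (deleteEdge G a b) x y)

IsDist : ∀ {n} → Graph n → Fin n → Fin n → ℕ → Set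
IsDist G x y d = Walk (Adj G) x y d × (∀ k → k < d → ¬ Walk (Adj G) x y k)

ExactlyTwoNeighbours : ∀ {n} → Graph n → Fin n → Fin n → Fin n → Set
ExactlyTwoNeighbours G v u w =
  u ≢ w × Adj G v u × Adj G v w × (∀ x → Adj G v x → x ≡ u ⊎ x ≡ w)

DistCondition : ∀ {n} → Graph n → Fin n → Fin n → Fin n → Set
DistCondition G v u w =
  ∀ v' → v' ≢ v → ∀ d₁ d₂ → IsDist G u v' d₁ → IsDist G w v' d₂ → ∣ d₁ - d₂ ∣ ≡ 2

module Submission where

-- Everything revolves around one condition: u and w are SEPARATED, i.e. they
-- lie in different components of G − v; each condition of the theorem is
-- shown equivalent to it.  After generalities on walks and shortest-path
-- distances, and two facts about G − v (a walk into v enters it from some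
-- vertex; a walk avoiding v at its end has a last visit to v), the key
-- observation is that every x ≠ v reaches u or w in G − v.  So if u, w are
-- joined in G − v, both G − v and G minus the edge uv are connected, which
-- rules out an articulation point and the bridge uv; conversely u, w resp.
-- u, v witness them.  If u, w are separated, x on u's side is reached from w
-- only through v and u, so d(w,x) = d(u,x) + 2.  Under the distance
-- condition, "d(w,·) = d(u,·) + 2" holds at u and spreads along G − v, so
-- it cannot reach w.  The theorem follows using the symmetry u ↔ w.

open import Defs
open import Data.Nat using (ℕ; zero; suc; _+_; _≤_; _<_; s≤s; ∣_-_∣; _≟_)
open import Data.Nat.Properties using (≤-refl; ≤-trans; ≤-antisym; ≮⇒≥; n≤0⇒n≡0; n≤1+n; m≤n+m; <-irrefl; suc-injective)
open import Data.Fin using (Fin) renaming (_≟_ to _≟ᶠ_)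
open import Data.Product using (_×_; _,_; proj₁; proj₂; ∃-syntax)
open import Data.Sum using (_⊎_; inj₁; inj₂; [_,_]′)
import Data.Sum as Sum
import Data.Product as Product
open import Data.Empty using (⊥; ⊥-elim)
open import Function using (id; _∘_)
open import Function.Bundles using (_⇔_; mk⇔)
open import Relation.Nullary using (¬_; yes; no)
open import Relation.Nullary.Decidable using (decidable-stable)
open import Relation.Binary.Definitions using (Symmetric)
open import Relation.Binary.PropositionalEquality using (_≡_; _≢_; refl; cong; ≢-sym)
import Relation.Binary.PropositionalEquality as ≡

∣m-n∣≡2⇒ : ∀ m n → ∣ m - n ∣ ≡ 2 → n ≡ 2 + m ⊎ m ≡ 2 + n
∣m-n∣≡2⇒ zero    n       eq = inj₁ eq
∣m-n∣≡2⇒ (suc m) zero    eq = inj₂ eq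
∣m-n∣≡2⇒ (suc m) (suc n) eq = Sum.map (cong suc) (cong suc) (∣m-n∣≡2⇒ m n eq)

⇒∣m-n∣≡2 : ∀ m n → n ≡ 2 + m ⊎ m ≡ 2 + n → ∣ m - n ∣ ≡ 2
⇒∣m-n∣≡2 zero    _       (inj₁ refl) = refl
⇒∣m-n∣≡2 (suc m) zero    (inj₂ refl) = refl
⇒∣m-n∣≡2 (suc m) (suc n) h           = ⇒∣m-n∣≡2 m n (Sum.map suc-injective suc-injective h)

offsets-cannot-flip : ∀ {a b c d} → a ≡ 2 + b → a ≤ suc c → d ≡ 2 + c → d ≤ suc b → ⊥
offsets-cannot-flip refl (s≤s b<c) refl (s≤s c<b) = <-irrefl refl (≤-trans b<c (≤-trans (n≤1+n _) c<b))

module _ {n : ℕ} {E : EdgeRel n} where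

  _++_ : ∀ {a b c k j} → Walk E a b k → Walk E b c j → Walk E a c (k + j)
  []      ++ q = q
  (e ∷ p) ++ q = e ∷ (p ++ q)

  snoc : ∀ {a b c k} → Walk E a b k → E b c → Walk E a c (suc k)
  snoc []       e = e ∷ []
  snoc (e′ ∷ p) e = e′ ∷ snoc p e

  reverse : Symmetric E → ∀ {a b k} → Walk E a b k → Walk E b a k
  reverse E-sym []      = []
  reverse E-sym (e ∷ p) = snoc (reverse E-sym p) (E-sym e)

  walk-length-zero : ∀ {a b} → Walk E a b zero → a ≡ b
  walk-length-zero [] = refl

  reach-step : ∀ {a b c} → E a b → Reachable E b c → Reachable E a c
  reach-step e (k , p) = suc k , e ∷ p

  reach-trans : ∀ {a b c} → Reachable E a b → Reachable E b c → Reachable E a c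
  reach-trans (k , p) (j , q) = k + j , p ++ q

  reach-sym : Symmetric E → ∀ {a b} → Reachable E a b → Reachable E b a
  reach-sym E-sym (k , p) = k , reverse E-sym p

module _ {n : ℕ} {E F : EdgeRel n} (E⊆F : ∀ {x y} → E x y → F x y) where

  mapWalk : ∀ {a b k} → Walk E a b k → Walk F a b k
  mapWalk []      = []
  mapWalk (e ∷ p) = E⊆F e ∷ mapWalk p

  mapReach : ∀ {a b} → Reachable E a b → Reachable F a b
  mapReach (k , p) = k , mapWalk p

module _ {n : ℕ} (G : Graph n) where

  dist≤walk : ∀ {a b d k} → IsDist G a b d → Walk (Adj G) a b k → d ≤ k
  dist≤walk (_ , minimal) p = ≮⇒≥ (λ k<d → minimal _ k<d p)

  dist-edge : ∀ {a x y dx dy} → IsDist G a x dx → Adj G x y → IsDist G a y dy → dy ≤ suc dx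
  dist-edge (px , _) x~y Dy = dist≤walk Dy (snoc px x~y)

  dist-self : ∀ {a d} → IsDist G a a d → d ≡ 0
  dist-self Da = n≤0⇒n≡0 (dist≤walk Da [])

  self-dist : ∀ {a} → IsDist G a a 0
  self-dist = [] , λ _ ()

  -- Joined vertices have a distance.  Adjacency is not decidable, so this
  -- only holds up to double negation (the least length is not computable).
  distance-exists : ∀ {a b k} → Walk (Adj G) a b k → ¬ ¬ (∃[ d ] IsDist G a b d)
  distance-exists {a} {b} {k} p no-distance = no-walk-below (suc k) ≤-refl p
    where
    no-walk-below : ∀ B {j} → j < B → ¬ Walk (Adj G) a b j
    no-walk-below (suc B) (s≤s j≤B) q =
      no-distance (_ , q , λ i i<j → no-walk-below B (≤-trans i<j j≤B))

module _ {n : ℕ} (G : Graph n) where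

  deleteEdge-flip : ∀ {a b x y} → deleteEdge G b a x y → deleteEdge G a b x y
  deleteEdge-flip (x~y , not-ba) = x~y , not-ba ∘ Sum.swap

  deleteEdge-sym : ∀ {a b} → Symmetric (deleteEdge G a b)
  deleteEdge-sym (x~y , not-ab) = sym G x~y , not-ab ∘ Sum.map Product.swap Product.swap ∘ Sum.swap

  IsBridge-sym : ∀ {a b} → IsBridge G a b → IsBridge G b a
  IsBridge-sym (a~b , x , y , x⇝y , x↛y) =
    sym G a~b , x , y , x⇝y , x↛y ∘ mapReach (deleteEdge-flip {b = _})

  deleteVertex⊆deleteEdge : ∀ {a v x y} → deleteVertex G v x y → deleteEdge G a v x y
  deleteVertex⊆deleteEdge (x~y , x≢v , y≢v) =
    x~y , [ y≢v ∘ proj₂ , x≢v ∘ proj₁ ]′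

module VertexDeletion {n : ℕ} (G : Graph n) (v : Fin n) where

  G−v : EdgeRel n
  G−v = deleteVertex G v

  G−v-sym : Symmetric G−v
  G−v-sym (x~y , x≢v , y≢v) = sym G x~y , y≢v , x≢v

  walk-source≢v : ∀ {y z k} → z ≢ v → Walk G−v y z k → y ≢ v
  walk-source≢v z≢v []                  = z≢v
  walk-source≢v _   ((_ , y≢v , _) ∷ _) = y≢v

  approach : {E : EdgeRel n} → (∀ {a b} → E a b → Adj G a b) →
             ∀ {x k} → x ≢ v → Walk E x v k → ∃[ a ] (E a v × Reachable G−v x a)
  approach E⊆G x≢v [] = ⊥-elim (x≢v refl)
  approach E⊆G {x} x≢v (_∷_ {y = y} e p) with y ≟ᶠ v
  ... | yes refl = x , e , 0 , []
  ... | no y≢v with approach E⊆G y≢v p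
  ...   | a , a~v , y⇝a = a , a~v , reach-step (E⊆G e , x≢v , y≢v) y⇝a

  data LastVisit (a z : Fin n) : ℕ → Set where
    via : ∀ {t m j} → Walk (Adj G) a v m → Adj G v t → Walk G−v t z j →
          LastVisit a z (m + suc j)

  lastVisit : ∀ {a z k} → z ≢ v → Walk (Adj G) a z k → Walk G−v a z k ⊎ LastVisit a z k
  lastVisit z≢v [] = inj₁ []
  lastVisit {a} z≢v (e ∷ p) with lastVisit z≢v p
  ... | inj₂ (via head v~t tail) = inj₂ (via (e ∷ head) v~t tail)
  ... | inj₁ q with a ≟ᶠ v
  ...   | yes refl = inj₂ (via [] e q)
  ...   | no a≢v   = inj₁ ((e , a≢v , walk-source≢v z≢v q) ∷ q)

swap-neighbours : ∀ {n} {G : Graph n} {v u w} →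
                  ExactlyTwoNeighbours G v u w → ExactlyTwoNeighbours G v w u
swap-neighbours (u≢w , v~u , v~w , neighbours) =
  ≢-sym u≢w , v~w , v~u , λ x v~x → Sum.swap (neighbours x v~x)

module TwoNeighbours {n : ℕ} (G : Graph n) (v u w : Fin n)
         (conn : Connected G) (ex : ExactlyTwoNeighbours G v u w) where

  open VertexDeletion G v

  u≢w : u ≢ w
  u≢w = proj₁ ex

  v~u : Adj G v u
  v~u = proj₁ (proj₂ ex)

  v~w : Adj G v w
  v~w = proj₁ (proj₂ (proj₂ ex))

  neighbours : ∀ x → Adj G v x → x ≡ u ⊎ x ≡ w
  neighbours = proj₂ (proj₂ (proj₂ ex))

  u≢v : u ≢ v
  u≢v refl = irrefl G v~u

  w≢v : w ≢ v
  w≢v refl = irrefl G v~w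

  Separated : Set
  Separated = ¬ Reachable G−v u w

  -- Every x ≠ v reaches u or w in G − v: its walk to v enters v via one
  -- of them.
  exit : ∀ {x} → x ≢ v → Reachable G−v x u ⊎ Reachable G−v x w
  exit x≢v with approach id x≢v (proj₂ (conn _ v))
  ... | a , a~v , x⇝a with neighbours a (sym G a~v)
  ...   | inj₁ refl = inj₁ x⇝a
  ...   | inj₂ refl = inj₂ x⇝a

  joined⇒reaches-w : Reachable G−v u w → ∀ {x} → x ≢ v → Reachable G−v x w
  joined⇒reaches-w u⇝w x≢v = [ (λ x⇝u → reach-trans x⇝u u⇝w) , id ]′ (exit x≢v)

  articulation⇒separated : IsArticulationPoint G v → Separated
  articulation⇒separated (x , y , x≢v , y≢v , _ , x↛y) u⇝w =
    x↛y (reach-trans (joined⇒reaches-w u⇝w x≢v) (reach-sym G−v-sym (joined⇒reaches-w u⇝w y≢v)))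

  separated⇒articulation : Separated → IsArticulationPoint G v
  separated⇒articulation sep = u , w , u≢v , w≢v , (2 , sym G v~u ∷ (v~w ∷ [])) , sep

  -- If u and w are joined in G − v, then G minus the edge uv is still
  -- connected: it contains G − v and the edge vw.
  bridge⇒separated : IsBridge G u v → Separated
  bridge⇒separated (_ , x , y , _ , x↛y) u⇝w =
    x↛y (reach-trans (to-w x) (reach-sym (deleteEdge-sym G) (to-w y)))
    where
    vw-is-not-uv : ¬ ((v ≡ u × w ≡ v) ⊎ (v ≡ v × w ≡ u))
    vw-is-not-uv = [ u≢v ∘ ≡.sym ∘ proj₁ , ≢-sym u≢w ∘ proj₂ ]′

    to-w : ∀ z → Reachable (deleteEdge G u v) z w
    to-w z with z ≟ᶠ v
    ... | yes refl = 1 , (v~w , vw-is-not-uv) ∷ []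
    ... | no z≢v   = mapReach (deleteVertex⊆deleteEdge G) (joined⇒reaches-w u⇝w z≢v)

  -- If u and w are separated, uv is a bridge: without it the only way into
  -- v is from w, so u could not reach v.
  separated⇒bridge : Separated → IsBridge G u v
  separated⇒bridge sep = sym G v~u , u , v , (1 , sym G v~u ∷ []) , λ (_ , p) → sep (enters-via-w p)
    where
    enters-via-w : ∀ {k} → Walk (deleteEdge G u v) u v k → Reachable G−v u w
    enters-via-w p with approach proj₁ u≢v p
    ... | a , (a~v , not-uv) , u⇝a with neighbours a (sym G a~v)
    ...   | inj₁ refl = ⊥-elim (not-uv (inj₁ (refl , refl)))
    ...   | inj₂ refl = u⇝a

  -- If u and w are separated, then on u's side of G − v every walk from w
  -- must pass through v and then u, so d(w,x) = d(u,x) + 2.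
  separated⇒far-side : Separated → ∀ {x d₁ d₂} → x ≢ v → Reachable G−v x u →
                       IsDist G u x d₁ → IsDist G w x d₂ → d₂ ≡ 2 + d₁
  separated⇒far-side sep {x} {d₁} x≢v x⇝u D₁ D₂ =
    ≤-antisym (dist≤walk G D₂ (sym G v~w ∷ (v~u ∷ proj₁ D₁))) (walks-from-w-are-long (proj₁ D₂))
    where
    w-misses-x : ∀ {j} → ¬ Walk G−v w x j
    w-misses-x p = sep (reach-sym G−v-sym (reach-trans (_ , p) x⇝u))

    walks-from-w-are-long : ∀ {k} → Walk (Adj G) w x k → 2 + d₁ ≤ k
    walks-from-w-are-long p with lastVisit x≢v p
    ... | inj₁ q = ⊥-elim (w-misses-x q)
    ... | inj₂ (via {t} {m} {j} head v~t tail) with neighbours t v~t | m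
    ...   | inj₂ refl | _     = ⊥-elim (w-misses-x tail)
    ...   | inj₁ refl | zero  = ⊥-elim (w≢v (walk-length-zero head))
    ...   | inj₁ refl | suc m′ =
      s≤s (≤-trans (s≤s (dist≤walk G D₁ (mapWalk proj₁ tail))) (m≤n+m (suc j) m′))

  FartherFromW : Fin n → Set
  FartherFromW x = ∀ {du dw} → IsDist G u x du → IsDist G w x dw → dw ≡ 2 + du

  -- Under the distance condition, FartherFromW holds at u and spreads along
  -- G − v; since it fails at w, u and w are separated.
  module _ (dist-cond : DistCondition G v u w) where

    farther-at-u : FartherFromW u
    farther-at-u {du} {dw} Du Dw with dist-self G Du
    ... | refl = [ id , (λ ()) ]′ (∣m-n∣≡2⇒ 0 dw (dist-cond u u≢v 0 dw Du Dw))

    -- At y the offset is ±2; it cannot be -2 since it is +2 at the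
    -- neighbour x and distances move by at most one along x — y.
    farther-step : ∀ {x y} → G−v x y → FartherFromW x → FartherFromW y
    farther-step {x} {y} (x~y , _ , y≢v) farther-x {du} {dw} Du Dw =
      decidable-stable (dw ≟ 2 + du) λ ¬goal →
        distance-exists G (proj₂ (conn u x)) λ (dux , Dux) →
        distance-exists G (proj₂ (conn w x)) λ (dwx , Dwx) →
        [ ¬goal
        , (λ du≡2+dw → offsets-cannot-flip du≡2+dw (dist-edge G Dux x~y Du)
                          (farther-x Dux Dwx) (dist-edge G Dw (sym G x~y) Dwx))
        ]′ (∣m-n∣≡2⇒ du dw (dist-cond y y≢v du dw Du Dw))

    farther-along : ∀ {x z k} → Walk G−v x z k → FartherFromW x → FartherFromW z
    farther-along []      farther-x = farther-x
    farther-along (e ∷ p) farther-x = farther-along p (farther-step e farther-x)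

    distCondition⇒separated : Separated
    distCondition⇒separated (_ , p) =
      distance-exists G (proj₂ (conn u w)) λ (duw , Duw) →
        0≢2+ (farther-along p farther-at-u Duw (self-dist G))
      where
      0≢2+ : ∀ {m} → 0 ≢ 2 + m
      0≢2+ ()

module Symmetrised {n : ℕ} (G : Graph n) (v u w : Fin n)
         (conn : Connected G) (ex : ExactlyTwoNeighbours G v u w) where

  open VertexDeletion G v
  open TwoNeighbours G v u w conn ex public
  private module Mirror = TwoNeighbours G v w u conn (swap-neighbours {G = G} {v} ex)

  separated-mirror : Separated → Mirror.Separated
  separated-mirror sep = sep ∘ reach-sym G−v-sym

  separated⇒bridges : Separated → IsBridge G u v × IsBridge G v w
  separated⇒bridges sep =
    separated⇒bridge sep , IsBridge-sym G (Mirror.separated⇒bridge (separated-mirror sep))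

  separated⇒distCondition : Separated → DistCondition G v u w
  separated⇒distCondition sep x x≢v d₁ d₂ D₁ D₂ =
    ⇒∣m-n∣≡2 d₁ d₂
      (Sum.map (λ x⇝u → separated⇒far-side sep x≢v x⇝u D₁ D₂)
               (λ x⇝w → Mirror.separated⇒far-side (separated-mirror sep) x≢v x⇝w D₂ D₁)
               (exit x≢v))

mainTheorem18 : ∀ {n} (G : Graph n) (v u w : Fin n) →
    Connected G → ExactlyTwoNeighbours G v u w →
    (IsArticulationPoint G v ⇔ (IsBridge G u v × IsBridge G v w))
      × ((IsBridge G u v × IsBridge G v w) ⇔ DistCondition G v u w)
mainTheorem18 G v u w conn ex =
  mk⇔ (separated⇒bridges ∘ articulation⇒separated)
      (separated⇒articulation ∘ bridge⇒separated ∘ proj₁) ,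
  mk⇔ (separated⇒distCondition ∘ bridge⇒separated ∘ proj₁)
      (separated⇒bridges ∘ distCondition⇒separated)
  where open Symmetrised G v u w conn ex
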